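{- A temporal relation $R \subseteq \mathbb{Q}^k$ is preserved by $\mathrm{mx}$ if and only if it is definable by a formula $\phi(v_1, \ldots, v_k)$ that is the conjunction of min-affine formulas, each of which is over a subset of $\{ v_1, \ldots, v_k \}$.
   Context: A temporal relation is a relation on $\mathbb{Q}$ first-order definable over $(\mathbb{Q};<)$; a function preserves a relation if applying it componentwise to tuples of the relation yields a tuple of the relation. The binary operation $\mathrm{mx}$ on $\mathbb{Q}$ is defined by $\mathrm{mx}(x,y)=\alpha(\min(x,y))$ if $x\neq y$ and $\mathrm{mx}(x,y)=\beta(x)$ if $x=y$, where $\alpha,\beta$ are unary operations preserving $<$ such that $\alpha(x)<\beta(x)<\alpha(x+\varepsilon)$ for all $x\in\mathbb{Q}$ and all rational $\varepsilon>0$. A boolean relation $S\subseteq\{0,1\}^n$ is near-affine if $S\cup\{(1,\ldots,1)\}$ is preserved by $a(x,y)=x\oplus y\oplus 1$. A formula $\phi$ is min-affine if there is a near-affine relation $T\subseteq\{0,1\}^n$ such that $\phi$ is of the form $\bigvee_{t\in T}\big((\bigwedge_{i,j:\,t_i=t_j=0} x_i=x_j)\wedge(\bigwedge_{i,j:\,t_i=0,t_j=1} x_i<x_j)\big)$ over variables $x_1,\ldots,x_n$, interpreted over the ordered rationals. The empty conjunction of min-affine formulas (true) and min-affine formulas with $T=\emptyset$ (false) are permitted. -}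

module Defs where

open import Data.Nat using (ℕ; suc)
open import Data.Fin using (Fin)
open import Data.Vec using (Vec; _∷_; lookup; zipWith; tabulate; replicate)
open import Data.Bool using (Bool; true; false; _xor_; not)
open import Data.Rational using (ℚ; _<_; _+_; _⊓_; _≟_; 0ℚ)
open import Data.Product using (Σ; ∃; _×_; _,_)
open import Data.Sum using (_⊎_)
open import Data.List using (List; []) renaming (_∷_ to _∷ₗ_)
open import Data.Unit using (⊤)
open import Relation.Nullary using (¬_; does)
open import Relation.Binary.PropositionalEquality using (_≡_)
open import Function.Definitions using (Injective)
open import Function.Bundles using (_⇔_)
open import Level using (0ℓ) renaming (suc to lsuc)

-- First-order formulas over the signature (<) (with equality), in n free
-- variables (de Bruijn style: ex binds variable zero).

data Fm (n : ℕ) : Set where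
  lt  : Fin n → Fin n → Fm n
  eq  : Fin n → Fin n → Fm n
  neg : Fm n → Fm n
  and : Fm n → Fm n → Fm n
  or  : Fm n → Fm n → Fm n
  ex  : Fm (suc n) → Fm n
  all : Fm (suc n) → Fm n

⟦_⟧ : ∀ {n} → Fm n → Vec ℚ n → Set
⟦ lt i j ⟧ ρ = lookup ρ i < lookup ρ j
⟦ eq i j ⟧ ρ = lookup ρ i ≡ lookup ρ j
⟦ neg φ ⟧ ρ = ¬ ⟦ φ ⟧ ρ
⟦ and φ ψ ⟧ ρ = ⟦ φ ⟧ ρ × ⟦ ψ ⟧ ρ
⟦ or φ ψ ⟧ ρ = ⟦ φ ⟧ ρ ⊎ ⟦ ψ ⟧ ρ
⟦ ex φ ⟧ ρ = Σ ℚ λ q → ⟦ φ ⟧ (q ∷ ρ)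
⟦ all φ ⟧ ρ = (q : ℚ) → ⟦ φ ⟧ (q ∷ ρ)

Rel : ℕ → Set₁
Rel k = Vec ℚ k → Set

Temporal : ∀ {k} → Rel k → Set
Temporal {k} R = Σ (Fm k) λ φ → ∀ x → R x ⇔ ⟦ φ ⟧ x

Preserves₂ : (ℚ → ℚ → ℚ) → ∀ {k} → Rel k → Set
Preserves₂ f R = ∀ x y → R x → R y → R (zipWith f x y)

StrictMono : (ℚ → ℚ) → Set
StrictMono g = ∀ x y → x < y → g x < g y

MxParams : (ℚ → ℚ) → (ℚ → ℚ) → Set
MxParams α β =
  StrictMono α × StrictMono β ×
  (∀ x → α x < β x) ×
  (∀ x ε → 0ℚ < ε → β x < α (x + ε))

mx : (ℚ → ℚ) → (ℚ → ℚ) → ℚ → ℚ → ℚ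
mx α β x y with does (x ≟ y)
... | true  = β x
... | false = α (x ⊓ y)

BRel : ℕ → Set₁
BRel n = Vec Bool n → Set

aOp : Bool → Bool → Bool
aOp x y = not (x xor y)

BPreserves₂ : (Bool → Bool → Bool) → ∀ {n} → BRel n → Set
BPreserves₂ f S = ∀ s t → S s → S t → S (zipWith f s t)

withOnes : ∀ {n} → BRel n → BRel n
withOnes {n} S t = S t ⊎ t ≡ replicate n true

NearAffine : ∀ {n} → BRel n → Set
NearAffine S = BPreserves₂ aOp (withOnes S)

minAffineClause : ∀ {n} → Vec Bool n → Vec ℚ n → Set
minAffineClause t x =
  (∀ i j → lookup t i ≡ false → lookup t j ≡ false → lookup x i ≡ lookup x j) ×
  (∀ i j → lookup t i ≡ false → lookup t j ≡ true → lookup x i < lookup x j)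

minAffineSem : ∀ {n} → BRel n → Vec ℚ n → Set
minAffineSem T x = Σ (Vec Bool _) λ t → T t × minAffineClause t x

-- A min-affine formula over a subset of {v₁,…,v_k}: its variables x₁,…,xₙ
-- are the distinct variables v_{σ(1)},…,v_{σ(n)} (σ injective).
record MinAffineOver (k : ℕ) : Set₁ where
  field
    n      : ℕ
    σ      : Fin n → Fin k
    σ-inj  : Injective _≡_ _≡_ σ
    T      : BRel n
    T-near : NearAffine T

open MinAffineOver public

⟦_⟧ᴹ : ∀ {k} → MinAffineOver k → Vec ℚ k → Set
⟦ m ⟧ᴹ v = minAffineSem (T m) (tabulate λ i → lookup v (σ m i))

⟦_⟧ᶜ : ∀ {k} → List (MinAffineOver k) → Vec ℚ k → Set
⟦ [] ⟧ᶜ v = ⊤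
⟦ m ∷ₗ ms ⟧ᶜ v = ⟦ m ⟧ᴹ v × ⟦ ms ⟧ᶜ v

MinAffineDefinable : ∀ {k} → Rel k → Set₁
MinAffineDefinable {k} R =
  Σ (List (MinAffineOver k)) λ ms → ∀ v → R v ⇔ ⟦ ms ⟧ᶜ v

-- Write a tuple's minimum pattern as t with tᵢ = 0 exactly at the coordinates where the minimum is
-- attained; a min-affine clause for t (t ≠ 1…1) says precisely that x has minimum pattern t.
--
-- (⇐) mx(x, y) has minimum pattern t if min x < min y, s if min y < min x, and, when the minima are
-- equal, t ⊕ s ⊕ 1 (or t if t = s); near-affinity of T is exactly what keeps that pattern in T.
--
-- (⇒) A temporal relation is invariant under order isomorphisms (back and forth). For each set S
-- of coordinates take T_S := the minimum patterns on S of the tuples of R; shifting one tuple so the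
-- minima coincide and applying mx shows T_S is near-affine, and R satisfies all these formulas.
-- Conversely, if v satisfies all of them, induction on |S| gives w ∈ R with the order type of v on
-- S: the formula for S yields u ∈ R with the same minima on S as v, and mx of a suitable affine
-- rescaling of u with a tuple realising v on S minus one minimal point realises v on S.

module Submission where

open import Defs hiding (n)
open import Data.Bool using (Bool; true; false)
open import Data.Bool.Properties using (not-involutive)
open import Data.Empty using (⊥-elim)
open import Data.Fin using (Fin; zero; suc)
open import Data.Fin.Properties using (any?; all?; suc-injective)
import Data.Fin.Subset as Subset
open import Data.Fin.Subset using (Subset; inside; outside; _∈_; ∣_∣; _⊂_) renaming (_-_ to _∖_)
open import Data.Fin.Subset.Properties using (_∈?_; ∈⊤; x∈p⇒p-x⊂p; x∈p∧x≢y⇒x∈p-y)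
open import Data.Fin.Subset.Induction using (⊂-wellFounded; Acc; acc)
open import Data.List using (List; []; _∷_; map; _++_)
open import Data.List.Membership.Propositional using () renaming (_∈_ to _∈ₗ_)
open import Data.List.Membership.Propositional.Properties using (∈-map⁺; ∈-++⁺ˡ; ∈-++⁺ʳ)
open import Data.List.Relation.Unary.Any using (here; there)
open import Data.Nat using (ℕ; zero; suc)
open import Data.Product using (Σ; ∃; _×_; _,_; proj₁; proj₂)
open import Data.Rational using (ℚ; _<_; _≤_; _+_; _-_; -_; _*_; 1/_; _⊓_; 0ℚ; 1ℚ; Positive; positive)
open import Data.Rational.Properties
  using ( _≟_; _<?_; _≤?_; <-cmp; <-irrefl; <-asym; <-trans; <⇒≤; <⇒≢; ≮⇒≥; <-dense
        ; ≤-refl; ≤-reflexive; ≤-trans; ≤-antisym; ≤-total; <-≤-trans; ≤-<-trans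
        ; +-monoˡ-<; +-monoʳ-<; *-monoˡ-<-pos; *-monoʳ-<-pos; +-inverseʳ; *-inverseʳ
        ; *-zeroˡ; *-zeroʳ; *-identityʳ; +-identityʳ; positive⁻¹; negative⁻¹; pos⇒nonZero; 1/pos⇒pos
        ; p≤q⇒p⊓q≡p; p≥q⇒p⊓q≡q )
open import Data.Rational.Solver using (module +-*-Solver)
open import Data.Sum using (_⊎_; inj₁; inj₂; [_,_]′)
open import Data.Unit using (tt)
open import Data.Vec using (Vec; []; _∷_; lookup; tabulate; zipWith; replicate; here; there)
  renaming (map to mapᵥ)
open import Data.Vec.Properties using (lookup∘tabulate; lookup-zipWith; lookup-map; lookup-replicate; ∷-injective)
open import Data.Vec.Relation.Binary.Pointwise.Extensional using (ext; Pointwise-≡⇒≡)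
open import Function using (_∘_; id; flip)
open import Function.Bundles using (_⇔_; mk⇔; Equivalence)
open import Function.Construct.Composition using (_⇔-∘_)
open import Function.Construct.Symmetry using (⇔-sym)
open import Function.Definitions using (Injective)
open import Level using (0ℓ)
open import Relation.Binary.Definitions using (Total; Transitive; tri<; tri≈; tri>)
open import Relation.Binary.PropositionalEquality
  using (_≡_; _≢_; refl; sym; trans; cong; cong₂; subst; subst₂; module ≡-Reasoning)
open import Relation.Nullary using (¬_; Dec; yes; no; contradiction)
open import Relation.Nullary.Decidable using (isNo; ¬?; _×-dec_; _→-dec_; dec-true; dec-false)
open import Relation.Unary using (Pred; Decidable; U; ∅)

open Equivalence using (to; from)

private
  variable
    n k : ℕ

module _ {A : Set} {_≼_ : A → A → Set} (≼-total : Total _≼_) (≼-trans : Transitive _≼_) where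

  private
    ≼-refl : ∀ {x} → x ≼ x
    ≼-refl {x} = [ id , id ]′ (≼-total x x)

  argmin : {P : Pred (Fin n) 0ℓ} → Decidable P → (f : Fin n → A) →
           (∀ i → ¬ P i) ⊎ ∃ λ i → P i × ∀ j → P j → f i ≼ f j
  argmin {zero} P? f = inj₁ λ ()
  argmin {suc n} P? f with argmin (P? ∘ suc) (f ∘ suc) | P? zero
  ... | inj₁ none | no ¬p₀ = inj₁ λ { zero → ¬p₀ ; (suc i) → none i }
  ... | inj₁ none | yes p₀ = inj₂ (zero , p₀ , λ { zero _ → ≼-refl ; (suc j) pj → ⊥-elim (none j pj) })
  ... | inj₂ (i , pi , least) | no ¬p₀ =
        inj₂ (suc i , pi , λ { zero p₀ → ⊥-elim (¬p₀ p₀) ; (suc j) pj → least j pj })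
  ... | inj₂ (i , pi , least) | yes p₀ with ≼-total (f zero) (f (suc i))
  ...   | inj₁ f₀≼fi = inj₂ (zero , p₀ , λ { zero _ → ≼-refl ; (suc j) pj → ≼-trans f₀≼fi (least j pj) })
  ...   | inj₂ fi≼f₀ = inj₂ (suc i , pi , λ { zero _ → fi≼f₀ ; (suc j) pj → least j pj })

argminℚ : {P : Pred (Fin n) 0ℓ} → Decidable P → (f : Fin n → ℚ) →
          (∀ i → ¬ P i) ⊎ ∃ λ i → P i × ∀ j → P j → f i ≤ f j
argminℚ = argmin ≤-total ≤-trans

argmaxℚ : {P : Pred (Fin n) 0ℓ} → Decidable P → (f : Fin n → ℚ) →
          (∀ i → ¬ P i) ⊎ ∃ λ i → P i × ∀ j → P j → f j ≤ f i
argmaxℚ = argmin (flip ≤-total) (flip ≤-trans)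

p<p+1 : ∀ p → p < p + 1ℚ
p<p+1 p = subst (_< p + 1ℚ) (+-identityʳ p) (+-monoʳ-< p (positive⁻¹ 1ℚ))

p-1<p : ∀ p → p - 1ℚ < p
p-1<p p = subst (p - 1ℚ <_) (+-identityʳ p) (+-monoʳ-< p (negative⁻¹ (- 1ℚ)))

interpolate : {P Q : Pred (Fin n) 0ℓ} → Decidable P → Decidable Q → (f : Fin n → ℚ) →
              (∀ {i j} → P i → Q j → f i < f j) →
              Σ ℚ λ q → (∀ {i} → P i → f i < q) × (∀ {j} → Q j → q < f j)
interpolate P? Q? f P<Q with argmaxℚ P? f | argminℚ Q? f
... | inj₁ noP | inj₁ noQ = 0ℚ , (λ {i} → ⊥-elim ∘ noP i) , (λ {j} → ⊥-elim ∘ noQ j)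
... | inj₂ (i , _ , max) | inj₁ noQ =
      f i + 1ℚ , (λ {i′} pi′ → ≤-<-trans (max i′ pi′) (p<p+1 (f i))) , (λ {j} → ⊥-elim ∘ noQ j)
... | inj₁ noP | inj₂ (j , _ , min) =
      f j - 1ℚ , (λ {i} → ⊥-elim ∘ noP i) , (λ {j′} qj′ → <-≤-trans (p-1<p (f j)) (min j′ qj′))
... | inj₂ (i , pi , max) | inj₂ (j , qj , min) with <-dense (P<Q pi qj)
...   | q , fi<q , q<fj =
        q , (λ {i′} pi′ → ≤-<-trans (max i′ pi′) fi<q) , (λ {j′} qj′ → <-≤-trans q<fj (min j′ qj′))

strictLowerBound : (f : Fin n → ℚ) → Σ ℚ λ l → ∀ i → l < f i
strictLowerBound f with interpolate {P = ∅} {Q = U} (λ _ → no λ ()) (λ _ → yes tt) f (λ ())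
... | l , _ , above = l , λ i → above tt

strictUpperBound : (f : Fin n → ℚ) → Σ ℚ λ h → ∀ i → f i < h
strictUpperBound f with interpolate {P = U} {Q = ∅} (λ _ → yes tt) (λ _ → no λ ()) f (λ _ ())
... | h , below , _ = h , λ i → below tt

record SameOrderOn (P : Pred (Fin n) 0ℓ) (x y : Vec ℚ n) : Set where
  constructor sameOrder
  field
    preserves-< : ∀ i j → P i → P j → lookup x i < lookup x j → lookup y i < lookup y j
    preserves-≡ : ∀ i j → P i → P j → lookup x i ≡ lookup x j → lookup y i ≡ lookup y j

open SameOrderOn

_≃_ : Vec ℚ n → Vec ℚ n → Set
_≃_ = SameOrderOn U

sameOrderOn-sym : {P : Pred (Fin n) 0ℓ} {x y : Vec ℚ n} → SameOrderOn P x y → SameOrderOn P y x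
sameOrderOn-sym {P = P} {x} {y} x~y = sameOrder reflect-< reflect-≡
  where
  reflect-< : ∀ i j → P i → P j → lookup y i < lookup y j → lookup x i < lookup x j
  reflect-< i j Pi Pj yi<yj with <-cmp (lookup x i) (lookup x j)
  ... | tri< xi<xj _ _ = xi<xj
  ... | tri≈ _ xi≡xj _ = ⊥-elim (<⇒≢ yi<yj (preserves-≡ x~y i j Pi Pj xi≡xj))
  ... | tri> _ _ xj<xi = ⊥-elim (<-asym yi<yj (preserves-< x~y j i Pj Pi xj<xi))
  reflect-≡ : ∀ i j → P i → P j → lookup y i ≡ lookup y j → lookup x i ≡ lookup x j
  reflect-≡ i j Pi Pj yi≡yj with <-cmp (lookup x i) (lookup x j)
  ... | tri< xi<xj _ _ = ⊥-elim (<⇒≢ (preserves-< x~y i j Pi Pj xi<xj) yi≡yj)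
  ... | tri≈ _ xi≡xj _ = xi≡xj
  ... | tri> _ _ xj<xi = ⊥-elim (<⇒≢ (preserves-< x~y j i Pj Pi xj<xi) (sym yi≡yj))

≃-∷ : {x y : Vec ℚ n} {q q′ : ℚ} → x ≃ y →
      (∀ i → (lookup x i < q → lookup y i < q′) × (q < lookup x i → q′ < lookup y i) ×
             (lookup x i ≡ q → lookup y i ≡ q′)) →
      (q ∷ x) ≃ (q′ ∷ y)
≃-∷ {x = x} {y} {q} {q′} x≃y position = sameOrder ∷-< ∷-≡
  where
  ∷-< : ∀ i j → U i → U j → lookup (q ∷ x) i < lookup (q ∷ x) j → lookup (q′ ∷ y) i < lookup (q′ ∷ y) j
  ∷-< zero    zero    _ _ q<q = ⊥-elim (<-irrefl refl q<q)
  ∷-< zero    (suc j) _ _ = proj₁ (proj₂ (position j))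
  ∷-< (suc i) zero    _ _ = proj₁ (position i)
  ∷-< (suc i) (suc j) _ _ = preserves-< x≃y i j tt tt
  ∷-≡ : ∀ i j → U i → U j → lookup (q ∷ x) i ≡ lookup (q ∷ x) j → lookup (q′ ∷ y) i ≡ lookup (q′ ∷ y) j
  ∷-≡ zero    zero    _ _ _ = refl
  ∷-≡ zero    (suc j) _ _ q≡xj = sym (proj₂ (proj₂ (position j)) (sym q≡xj))
  ∷-≡ (suc i) zero    _ _ = proj₂ (proj₂ (position i))
  ∷-≡ (suc i) (suc j) _ _ = preserves-≡ x≃y i j tt tt

-- Back-and-forth: this is why truth of first-order formulas over (ℚ; <) depends only on order types.
≃-extend : {x y : Vec ℚ n} → x ≃ y → ∀ q → Σ ℚ λ q′ → (q ∷ x) ≃ (q′ ∷ y)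
≃-extend {x = x} {y} x≃y q with any? (λ i → lookup x i ≟ q)
... | yes (i , xi≡q) = lookup y i , ≃-∷ x≃y λ j →
        (λ xj<q → preserves-< x≃y j i tt tt (subst (lookup x j <_) (sym xi≡q) xj<q)) ,
        (λ q<xj → preserves-< x≃y i j tt tt (subst (_< lookup x j) (sym xi≡q) q<xj)) ,
        (λ xj≡q → preserves-≡ x≃y j i tt tt (trans xj≡q (sym xi≡q)))
... | no q∉x with interpolate (λ i → lookup x i <? q) (λ i → q <? lookup x i) (lookup y)
                              (λ {i} {j} xi<q q<xj → preserves-< x≃y i j tt tt (<-trans xi<q q<xj))
...   | q′ , below , above = q′ , ≃-∷ x≃y λ i → below , above , λ xi≡q → ⊥-elim (q∉x (i , xi≡q))

⟦⟧-resp-≃ : (φ : Fm n) {x y : Vec ℚ n} → x ≃ y → ⟦ φ ⟧ x → ⟦ φ ⟧ y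
⟦⟧-resp-≃ (lt i j) x≃y = preserves-< x≃y i j tt tt
⟦⟧-resp-≃ (eq i j) x≃y = preserves-≡ x≃y i j tt tt
⟦⟧-resp-≃ (neg φ) x≃y ¬φx φy = ¬φx (⟦⟧-resp-≃ φ (sameOrderOn-sym x≃y) φy)
⟦⟧-resp-≃ (and φ ψ) x≃y (φx , ψx) = ⟦⟧-resp-≃ φ x≃y φx , ⟦⟧-resp-≃ ψ x≃y ψx
⟦⟧-resp-≃ (or φ ψ) x≃y (inj₁ φx) = inj₁ (⟦⟧-resp-≃ φ x≃y φx)
⟦⟧-resp-≃ (or φ ψ) x≃y (inj₂ ψx) = inj₂ (⟦⟧-resp-≃ ψ x≃y ψx)
⟦⟧-resp-≃ (ex φ) x≃y (q , φqx) with ≃-extend x≃y q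
... | q′ , qx≃q′y = q′ , ⟦⟧-resp-≃ φ qx≃q′y φqx
⟦⟧-resp-≃ (all φ) x≃y ∀φx q′ with ≃-extend (sameOrderOn-sym x≃y) q′
... | q , q′y≃qx = ⟦⟧-resp-≃ φ (sameOrderOn-sym q′y≃qx) (∀φx q)

OrderInvariant : Rel k → Set
OrderInvariant R = ∀ {x y} → x ≃ y → R x → R y

temporal⇒orderInvariant : {R : Rel k} → Temporal R → OrderInvariant R
temporal⇒orderInvariant (φ , R⇔φ) x≃y Rx = from (R⇔φ _) (⟦⟧-resp-≃ φ x≃y (to (R⇔φ _) Rx))

strictMono-≃ : {g : ℚ → ℚ} → StrictMono g → (x : Vec ℚ n) → x ≃ mapᵥ g x
strictMono-≃ {g = g} g-mono x = sameOrder
  (λ i j _ _ xi<xj → subst₂ _<_ (sym (lookup-map i g x)) (sym (lookup-map j g x)) (g-mono _ _ xi<xj))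
  (λ i j _ _ xi≡xj → trans (lookup-map i g x) (trans (cong g xi≡xj) (sym (lookup-map j g x))))

open +-*-Solver using (solve; _:+_; _:-_; _:=_)

strictMono⇒mono : {g : ℚ → ℚ} → StrictMono g → ∀ {p q} → p ≤ q → g p ≤ g q
strictMono⇒mono g-mono {p} {q} p≤q with <-cmp p q
... | tri< p<q _ _ = <⇒≤ (g-mono p q p<q)
... | tri≈ _ refl _ = ≤-refl
... | tri> _ _ q<p = ⊥-elim (<-irrefl refl (<-≤-trans q<p p≤q))

translation : ∀ a b → Σ (ℚ → ℚ) λ g → StrictMono g × g a ≡ b
translation a b = (_+ (b - a)) , (λ _ _ → +-monoˡ-< (b - a)) ,
                  solve 2 (λ a b → a :+ (b :- a) := b) refl a b

0<q-p : ∀ {p q} → p < q → 0ℚ < q - p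
0<q-p {p} {q} p<q = subst (_< q - p) (+-inverseʳ p) (+-monoˡ-< (- p) p<q)

affine : ∀ {a b c d} → a < b → c < d → Σ (ℚ → ℚ) λ g → StrictMono g × g a ≡ c × g b ≡ d
affine {a} {b} {c} {d} a<b c<d = g , g-mono , ga≡c , gb≡d
  where
  instance
    b-a-pos : Positive (b - a)
    b-a-pos = positive (0<q-p a<b)
    d-c-pos : Positive (d - c)
    d-c-pos = positive (0<q-p c<d)
  r : ℚ
  r = (1/ (b - a)) {{pos⇒nonZero (b - a)}}
  instance
    r-pos : Positive r
    r-pos = 1/pos⇒pos (b - a)
  g : ℚ → ℚ
  g y = c + (d - c) * ((y - a) * r)
  g-mono : StrictMono g
  g-mono y y′ y<y′ = +-monoʳ-< c (*-monoʳ-<-pos (d - c) (*-monoˡ-<-pos r (+-monoˡ-< (- a) y<y′)))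
  open ≡-Reasoning
  ga≡c : g a ≡ c
  ga≡c = begin
    c + (d - c) * ((a - a) * r) ≡⟨ cong (λ e → c + (d - c) * (e * r)) (+-inverseʳ a) ⟩
    c + (d - c) * (0ℚ * r)      ≡⟨ cong (λ e → c + (d - c) * e) (*-zeroˡ r) ⟩
    c + (d - c) * 0ℚ            ≡⟨ cong (c +_) (*-zeroʳ (d - c)) ⟩
    c + 0ℚ                      ≡⟨ +-identityʳ c ⟩
    c                           ∎
  gb≡d : g b ≡ d
  gb≡d = begin
    c + (d - c) * ((b - a) * r) ≡⟨ cong (λ e → c + (d - c) * e) (*-inverseʳ (b - a) {{pos⇒nonZero (b - a)}}) ⟩
    c + (d - c) * 1ℚ            ≡⟨ cong (c +_) (*-identityʳ (d - c)) ⟩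
    c + (d - c)                 ≡⟨ solve 2 (λ c d → c :+ (d :- c) := d) refl c d ⟩
    d                           ∎

separatingMap : {High : Pred (Fin n) 0ℓ} → Decidable High → (f : Fin n → ℚ) → ∀ {c l h} → l < h →
                (∀ {i} → High i → c < f i) →
                Σ (ℚ → ℚ) λ g → StrictMono g × g c ≡ l × (∀ {i} → High i → h ≤ g (f i))
separatingMap High? f {c} {l} {h} l<h c<High with argminℚ High? f
... | inj₁ none =
      let g , g-mono , gc≡l = translation c l
      in g , g-mono , gc≡l , λ {i} High-i → ⊥-elim (none i High-i)
... | inj₂ (j , High-j , j-least) =
      let g , g-mono , gc≡l , gfj≡h = affine (c<High High-j) l<h
      in g , g-mono , gc≡l , λ {i} High-i → subst (_≤ g (f i)) gfj≡h (strictMono⇒mono g-mono (j-least i High-i))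

module _ {α β : ℚ → ℚ} where

  mx-diag : ∀ x → mx α β x x ≡ β x
  mx-diag x rewrite dec-true (x ≟ x) refl = refl

  mx-≢ : ∀ {x y} → x ≢ y → mx α β x y ≡ α (x ⊓ y)
  mx-≢ {x} {y} x≢y rewrite dec-false (x ≟ y) x≢y = refl

  mx-< : ∀ {x y} → x < y → mx α β x y ≡ α x
  mx-< x<y = trans (mx-≢ (<⇒≢ x<y)) (cong α (p≤q⇒p⊓q≡p (<⇒≤ x<y)))

  mx-> : ∀ {x y} → y < x → mx α β x y ≡ α y
  mx-> y<x = trans (mx-≢ (<⇒≢ y<x ∘ sym)) (cong α (p≥q⇒p⊓q≡q (<⇒≤ y<x)))

  mx-comm : ∀ x y → mx α β x y ≡ mx α β y x
  mx-comm x y with <-cmp x y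
  ... | tri< x<y _ _ = trans (mx-< x<y) (sym (mx-> x<y))
  ... | tri≈ _ refl _ = refl
  ... | tri> _ _ y<x = trans (mx-> y<x) (sym (mx-< y<x))

module Mx {α β : ℚ → ℚ} (params : MxParams α β) where

  α-mono : StrictMono α
  α-mono = proj₁ params

  α<β : ∀ x → α x < β x
  α<β = proj₁ (proj₂ (proj₂ params))

  β<α : ∀ {c x} → c < x → β c < α x
  β<α {c} {x} c<x =
    subst (λ y → β c < α y) (solve 2 (λ c x → c :+ (x :- c) := x) refl c x)
          (proj₂ (proj₂ (proj₂ params)) c (x - c) (0<q-p c<x))

  β<mx : ∀ {c x y} → c < x → c < y → β c < mx α β x y
  β<mx {c} {x} {y} c<x c<y with <-cmp x y
  ... | tri< x<y _ _ = subst (β c <_) (sym (mx-< x<y)) (β<α c<x)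
  ... | tri≈ _ refl _ = subst (β c <_) (sym (mx-diag x)) (proj₁ (proj₂ params) c x c<x)
  ... | tri> _ _ y<x = subst (β c <_) (sym (mx-> y<x)) (β<α c<y)

Marks : Bool → ℚ → ℚ → Set
Marks false d q = q ≡ d
Marks true  d q = d < q

marks⇒≤ : ∀ b {d q} → Marks b d q → d ≤ q
marks⇒≤ false refl = ≤-refl
marks⇒≤ true  d<q  = <⇒≤ d<q

record AtLevel (d : ℚ) (t : Vec Bool n) (x : Vec ℚ n) : Set where
  constructor atLevel
  field marks : ∀ i → Marks (lookup t i) d (lookup x i)

open AtLevel

marks-at : ∀ {d t} {x : Vec ℚ n} {b} → AtLevel d t x → ∀ i → lookup t i ≡ b → Marks b d (lookup x i)
marks-at lvl i refl = marks lvl i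

atLevel⇒clause : ∀ {d t} {x : Vec ℚ n} → AtLevel d t x → minAffineClause t x
atLevel⇒clause lvl =
  (λ i j ti tj → trans (marks-at lvl i ti) (sym (marks-at lvl j tj))) ,
  (λ i j ti tj → subst (_< _) (sym (marks-at lvl i ti)) (marks-at lvl j tj))

clause⇒atLevel : ∀ {t} {x : Vec ℚ n} {z} → minAffineClause t x → lookup t z ≡ false → AtLevel (lookup x z) t x
clause⇒atLevel {t = t} {x} {z} (same , below) tz = atLevel marks-i
  where
  marks-i : ∀ i → Marks (lookup t i) (lookup x z) (lookup x i)
  marks-i i with lookup t i in ti
  ... | false = same i z ti tz
  ... | true  = below z i tz ti

Minimal : Vec ℚ n → Fin n → Set
Minimal x i = ∀ j → lookup x i ≤ lookup x j

minimal? : (x : Vec ℚ n) → ∀ i → Dec (Minimal x i)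
minimal? x i = all? λ j → lookup x i ≤? lookup x j

∃-minimal : Fin n → (x : Vec ℚ n) → ∃ (Minimal x)
∃-minimal i₀ x with argminℚ {P = U} (λ _ → yes tt) (lookup x)
... | inj₁ empty = ⊥-elim (empty i₀ tt)
... | inj₂ (i , _ , least) = i , λ j → least j tt

record MinIndicator (t : Vec Bool n) (x : Vec ℚ n) : Set where
  constructor minIndicator
  field indicates : ∀ i → lookup t i ≡ false ⇔ Minimal x i

open MinIndicator

atLevel⇒minIndicator : ∀ {d t} {x : Vec ℚ n} {z} → AtLevel d t x → lookup t z ≡ false → MinIndicator t x
atLevel⇒minIndicator {t = t} {x} {z} lvl tz = minIndicator λ i → mk⇔ (minimal i) (at-minimum i)
  where
  minimal : ∀ i → lookup t i ≡ false → Minimal x i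
  minimal i ti j = subst (_≤ lookup x j) (sym (marks-at lvl i ti)) (marks⇒≤ _ (marks lvl j))
  at-minimum : ∀ i → Minimal x i → lookup t i ≡ false
  at-minimum i xi-min with lookup t i in ti
  ... | false = refl
  ... | true  = ⊥-elim (<-irrefl refl (<-≤-trans (marks-at lvl i ti)
                                       (≤-trans (xi-min z) (≤-reflexive (marks-at lvl z tz)))))

minIndicator⇒atLevel : ∀ {t} {x : Vec ℚ n} {z} → MinIndicator t x → Minimal x z → AtLevel (lookup x z) t x
minIndicator⇒atLevel {t = t} {x} {z} ind z-min = atLevel marks-i
  where
  marks-i : ∀ i → Marks (lookup t i) (lookup x z) (lookup x i)
  marks-i i with lookup t i in ti
  ... | false = ≤-antisym (to (indicates ind i) ti z) (z-min i)
  ... | true  with lookup x z <? lookup x i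
  ...   | yes xz<xi = xz<xi
  ...   | no xz≮xi = contradiction (trans (sym ti) (from (indicates ind i) i-min)) λ ()
    where
    i-min : Minimal x i
    i-min j = ≤-trans (≮⇒≥ xz≮xi) (z-min j)

minIndicator⇒clause : ∀ {t} {x : Vec ℚ n} → MinIndicator t x → minAffineClause t x
minIndicator⇒clause {t = t} {x} ind = same , below
  where
  same : ∀ i j → lookup t i ≡ false → lookup t j ≡ false → lookup x i ≡ lookup x j
  same i j ti tj = ≤-antisym (to (indicates ind i) ti j) (to (indicates ind j) tj i)
  below : ∀ i j → lookup t i ≡ false → lookup t j ≡ true → lookup x i < lookup x j
  below i j ti tj = subst (_< lookup x j) (sym (marks-at lvl i ti)) (marks-at lvl j tj)
    where
    lvl : AtLevel (lookup x i) t x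
    lvl = minIndicator⇒atLevel ind (to (indicates ind i) ti)

clause⇒minIndicator : ∀ {t} {x : Vec ℚ n} {z} → minAffineClause t x → lookup t z ≡ false → MinIndicator t x
clause⇒minIndicator clause tz = atLevel⇒minIndicator (clause⇒atLevel clause tz) tz

minIndicator-zero : ∀ {t} {x : Vec ℚ n} → MinIndicator t x → Fin n → ∃ λ i → lookup t i ≡ false
minIndicator-zero {x = x} ind i₀ with ∃-minimal i₀ x
... | i , i-min = i , from (indicates ind i) i-min

isNo≡false⇔ : {P : Set} (P? : Dec P) → isNo P? ≡ false ⇔ P
isNo≡false⇔ (yes p) = mk⇔ (λ _ → p) (λ _ → refl)
isNo≡false⇔ (no ¬p) = mk⇔ (λ ()) (λ p → ⊥-elim (¬p p))

minIndicator-exists : (x : Vec ℚ n) → ∃ λ t → MinIndicator t x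
minIndicator-exists x = tabulate (λ i → isNo (minimal? x i)) , minIndicator λ i →
  subst (λ b → b ≡ false ⇔ Minimal x i) (sym (lookup∘tabulate _ i)) (isNo≡false⇔ (minimal? x i))

-- Min-affine formulas are preserved by mx

ones-or-zero : (t : Vec Bool n) → t ≡ replicate n true ⊎ ∃ λ i → lookup t i ≡ false
ones-or-zero [] = inj₁ refl
ones-or-zero (false ∷ t) = inj₂ (zero , refl)
ones-or-zero (true ∷ t) with ones-or-zero t
... | inj₁ refl = inj₁ refl
... | inj₂ (i , ti) = inj₂ (suc i , ti)

ones-aOp : (s : Vec Bool n) → zipWith aOp (replicate n true) s ≡ s
ones-aOp [] = refl
ones-aOp (b ∷ s) = cong₂ _∷_ (not-involutive b) (ones-aOp s)

aOp-ones : (t : Vec Bool n) → zipWith aOp t (replicate n true) ≡ t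
aOp-ones [] = refl
aOp-ones (false ∷ t) = cong (false ∷_) (aOp-ones t)
aOp-ones (true ∷ t) = cong (true ∷_) (aOp-ones t)

aOp≡true⇒≡ : ∀ a b → aOp a b ≡ true → a ≡ b
aOp≡true⇒≡ false false _ = refl
aOp≡true⇒≡ true  true  _ = refl
aOp≡true⇒≡ false true  ()
aOp≡true⇒≡ true  false ()

aOp≡ones⇒≡ : (t s : Vec Bool n) → zipWith aOp t s ≡ replicate n true → t ≡ s
aOp≡ones⇒≡ [] [] _ = refl
aOp≡ones⇒≡ (a ∷ t) (b ∷ s) ≡ones with ∷-injective ≡ones
... | ab≡true , ts≡ones = cong₂ _∷_ (aOp≡true⇒≡ a b ab≡true) (aOp≡ones⇒≡ t s ts≡ones)

clause-ones : (x : Vec ℚ n) → minAffineClause (replicate n true) x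
clause-ones x = (λ i _ ti _ → ⊥-elim (ones-not-false i ti)) , (λ i _ ti _ → ⊥-elim (ones-not-false i ti))
  where
  ones-not-false : ∀ i → lookup (replicate _ true) i ≢ false
  ones-not-false i ti = contradiction (trans (sym (lookup-replicate i true)) ti) λ ()

restrict : (Fin n → Fin k) → Vec ℚ k → Vec ℚ n
restrict σ x = tabulate λ i → lookup x (σ i)

lookup-restrict : (σ : Fin n → Fin k) (x : Vec ℚ k) → ∀ i → lookup (restrict σ x) i ≡ lookup x (σ i)
lookup-restrict σ x = lookup∘tabulate _

restrict-zipWith : (σ : Fin n → Fin k) (f : ℚ → ℚ → ℚ) (x y : Vec ℚ k) →
                   restrict σ (zipWith f x y) ≡ zipWith f (restrict σ x) (restrict σ y)
restrict-zipWith σ f x y = Pointwise-≡⇒≡ (ext λ i → begin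
  lookup (restrict σ (zipWith f x y)) i                 ≡⟨ lookup-restrict σ (zipWith f x y) i ⟩
  lookup (zipWith f x y) (σ i)                          ≡⟨ lookup-zipWith f (σ i) x y ⟩
  f (lookup x (σ i)) (lookup y (σ i))                   ≡⟨ cong₂ f (lookup-restrict σ x i) (lookup-restrict σ y i) ⟨
  f (lookup (restrict σ x) i) (lookup (restrict σ y) i) ≡⟨ lookup-zipWith f i (restrict σ x) (restrict σ y) ⟨
  lookup (zipWith f (restrict σ x) (restrict σ y)) i    ∎)
  where open ≡-Reasoning

restrict-map : (σ : Fin n → Fin k) (g : ℚ → ℚ) (x : Vec ℚ k) → restrict σ (mapᵥ g x) ≡ mapᵥ g (restrict σ x)
restrict-map σ g x = Pointwise-≡⇒≡ (ext λ i → begin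
  lookup (restrict σ (mapᵥ g x)) i ≡⟨ lookup-restrict σ (mapᵥ g x) i ⟩
  lookup (mapᵥ g x) (σ i)          ≡⟨ lookup-map (σ i) g x ⟩
  g (lookup x (σ i))               ≡⟨ cong g (lookup-restrict σ x i) ⟨
  g (lookup (restrict σ x) i)      ≡⟨ lookup-map i g (restrict σ x) ⟨
  lookup (mapᵥ g (restrict σ x)) i ∎)
  where open ≡-Reasoning

atLevel-map : ∀ {g : ℚ → ℚ} {d t} {x : Vec ℚ n} → StrictMono g → AtLevel d t x → AtLevel (g d) t (mapᵥ g x)
atLevel-map {g = g} {t = t} {x} g-mono lvl = atLevel λ i →
  subst (Marks (lookup t i) (g _)) (sym (lookup-map i g x)) (marks-map (lookup t i) (marks lvl i))
  where
  marks-map : ∀ b {d q} → Marks b d q → Marks b (g d) (g q)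
  marks-map false q≡d = cong g q≡d
  marks-map true  d<q = g-mono _ _ d<q

module _ {α β : ℚ → ℚ} (params : MxParams α β) where
  open Mx params

  marks-mx-< : ∀ {a b p q x y} → a < b → Marks p a x → Marks q b y → Marks p (α a) (mx α β x y)
  marks-mx-< {p = false} a<b refl y-marks = mx-< (<-≤-trans a<b (marks⇒≤ _ y-marks))
  marks-mx-< {p = true}  a<b a<x  y-marks = <-trans (α<β _) (β<mx a<x (<-≤-trans a<b (marks⇒≤ _ y-marks)))

  marks-mx-aOp : ∀ {a p q x y} → Marks p a x → Marks q a y → Marks (aOp p q) (α a) (mx α β x y)
  marks-mx-aOp {a} {false} {false} refl refl = subst (α a <_) (sym (mx-diag a)) (α<β a)
  marks-mx-aOp {p = false} {true}  refl a<y  = mx-< a<y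
  marks-mx-aOp {p = true}  {false} a<x  refl = mx-> a<x
  marks-mx-aOp {p = true}  {true}  a<x  a<y  = <-trans (α<β _) (β<mx a<x a<y)

  marks-mx-same : ∀ {a p x y} → Marks p a x → Marks p a y → Marks p (β a) (mx α β x y)
  marks-mx-same {a} {false} refl refl = mx-diag a
  marks-mx-same {p = true}  a<x  a<y  = β<mx a<x a<y

  module _ {x y : Vec ℚ n} where

    atLevel-mx-< : ∀ {a b t s} → a < b → AtLevel a t x → AtLevel b s y → AtLevel (α a) t (zipWith (mx α β) x y)
    atLevel-mx-< a<b x-lvl y-lvl = atLevel λ i →
      subst (Marks _ _) (sym (lookup-zipWith _ i x y)) (marks-mx-< a<b (marks x-lvl i) (marks y-lvl i))

    atLevel-mx-> : ∀ {a b t s} → b < a → AtLevel a t x → AtLevel b s y → AtLevel (α b) s (zipWith (mx α β) x y)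
    atLevel-mx-> b<a x-lvl y-lvl = atLevel λ i →
      subst (Marks _ _) (trans (mx-comm (lookup y i) (lookup x i)) (sym (lookup-zipWith _ i x y)))
            (marks-mx-< b<a (marks y-lvl i) (marks x-lvl i))

    atLevel-mx-aOp : ∀ {a t s} → AtLevel a t x → AtLevel a s y →
                     AtLevel (α a) (zipWith aOp t s) (zipWith (mx α β) x y)
    atLevel-mx-aOp {t = t} {s} x-lvl y-lvl = atLevel λ i →
      subst₂ (λ b q → Marks b _ q) (sym (lookup-zipWith aOp i t s)) (sym (lookup-zipWith _ i x y))
             (marks-mx-aOp (marks x-lvl i) (marks y-lvl i))

    atLevel-mx-same : ∀ {a t} → AtLevel a t x → AtLevel a t y → AtLevel (β a) t (zipWith (mx α β) x y)
    atLevel-mx-same x-lvl y-lvl = atLevel λ i →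
      subst (Marks _ _) (sym (lookup-zipWith _ i x y)) (marks-mx-same (marks x-lvl i) (marks y-lvl i))

  minAffineSem-mx-atLevel : ∀ {T : BRel n} {t s a b} {x y : Vec ℚ n} → NearAffine T → T t → T s →
                            AtLevel a t x → AtLevel b s y → minAffineSem T (zipWith (mx α β) x y)
  minAffineSem-mx-atLevel {t = t} {s} {a} {b} near Tt Ts x-lvl y-lvl with <-cmp a b
  ... | tri< a<b _ _ = t , Tt , atLevel⇒clause (atLevel-mx-< a<b x-lvl y-lvl)
  ... | tri> _ _ b<a = s , Ts , atLevel⇒clause (atLevel-mx-> b<a x-lvl y-lvl)
  ... | tri≈ _ refl _ with near t s (inj₁ Tt) (inj₁ Ts)
  ...   | inj₁ T-ts = zipWith aOp t s , T-ts , atLevel⇒clause (atLevel-mx-aOp x-lvl y-lvl)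
  ...   | inj₂ ts≡ones with aOp≡ones⇒≡ t s ts≡ones
  ...     | refl = t , Tt , atLevel⇒clause (atLevel-mx-same x-lvl y-lvl)

  minAffineSem-mx : ∀ {T : BRel n} {x y : Vec ℚ n} → NearAffine T →
                    minAffineSem T x → minAffineSem T y → minAffineSem T (zipWith (mx α β) x y)
  minAffineSem-mx {x = x} {y} near (t , Tt , x-t) (s , Ts , y-s) with ones-or-zero t | ones-or-zero s
  ... | inj₁ refl | _ = t , Tt , clause-ones (zipWith (mx α β) x y)
  ... | inj₂ _ | inj₁ refl = s , Ts , clause-ones (zipWith (mx α β) x y)
  ... | inj₂ (i , ti) | inj₂ (j , sj) =
        minAffineSem-mx-atLevel {x = x} {y} near Tt Ts (clause⇒atLevel x-t ti) (clause⇒atLevel y-s sj)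

  ⟦⟧ᶜ-mx : (ms : List (MinAffineOver k)) {x y : Vec ℚ k} →
           ⟦ ms ⟧ᶜ x → ⟦ ms ⟧ᶜ y → ⟦ ms ⟧ᶜ (zipWith (mx α β) x y)
  ⟦⟧ᶜ-mx [] _ _ = tt
  ⟦⟧ᶜ-mx (m ∷ ms) {x} {y} (x-m , x-ms) (y-m , y-ms) =
    subst (minAffineSem (T m)) (sym (restrict-zipWith (σ m) _ x y))
          (minAffineSem-mx {x = restrict (σ m) x} {restrict (σ m) y} (T-near m) x-m y-m) ,
    ⟦⟧ᶜ-mx ms x-ms y-ms

  minAffineDefinable⇒preserved : {R : Rel k} → MinAffineDefinable R → Preserves₂ (mx α β) R
  minAffineDefinable⇒preserved (ms , R⇔ms) x y Rx Ry =
    from (R⇔ms _) (⟦⟧ᶜ-mx ms (to (R⇔ms x) Rx) (to (R⇔ms y) Ry))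

enumerate : (S : Subset k) → Fin ∣ S ∣ → Fin k
enumerate (outside ∷ S) p       = suc (enumerate S p)
enumerate (inside  ∷ S) zero    = zero
enumerate (inside  ∷ S) (suc p) = suc (enumerate S p)

enumerate-injective : (S : Subset k) → Injective _≡_ _≡_ (enumerate S)
enumerate-injective (outside ∷ S) e = enumerate-injective S (suc-injective e)
enumerate-injective (inside  ∷ S) {zero}  {zero}  _ = refl
enumerate-injective (inside  ∷ S) {suc p} {suc q} e = cong suc (enumerate-injective S (suc-injective e))

enumerate-∈ : (S : Subset k) (p : Fin ∣ S ∣) → enumerate S p ∈ S
enumerate-∈ (outside ∷ S) p       = there (enumerate-∈ S p)
enumerate-∈ (inside  ∷ S) zero    = here
enumerate-∈ (inside  ∷ S) (suc p) = there (enumerate-∈ S p)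

enumerate-onto : (S : Subset k) → ∀ {i} → i ∈ S → ∃ λ p → enumerate S p ≡ i
enumerate-onto (inside ∷ S) here = zero , refl
enumerate-onto (outside ∷ S) (there i∈S) with enumerate-onto S i∈S
... | p , refl = p , refl
enumerate-onto (inside ∷ S) (there i∈S) with enumerate-onto S i∈S
... | p , refl = suc p , refl

allSubsets : ∀ k → List (Subset k)
allSubsets zero    = [] ∷ []
allSubsets (suc k) = map (outside ∷_) (allSubsets k) ++ map (inside ∷_) (allSubsets k)

∈-allSubsets : (S : Subset k) → S ∈ₗ allSubsets k
∈-allSubsets [] = here refl
∈-allSubsets (outside ∷ S) = ∈-++⁺ˡ (∈-map⁺ (outside ∷_) (∈-allSubsets S))
∈-allSubsets (inside  ∷ S) = ∈-++⁺ʳ (map (outside ∷_) (allSubsets _)) (∈-map⁺ (inside ∷_) (∈-allSubsets S))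

MinimalIn : Subset k → Vec ℚ k → Fin k → Set
MinimalIn S x i = ∀ j → j ∈ S → lookup x i ≤ lookup x j

minimalIn? : (S : Subset k) (x : Vec ℚ k) → ∀ i → Dec (MinimalIn S x i)
minimalIn? S x i = all? λ j → (j ∈? S) →-dec (lookup x i ≤? lookup x j)

minimalIn-≡ : ∀ {S} {x : Vec ℚ k} {i m} → i ∈ S → m ∈ S →
              MinimalIn S x i → MinimalIn S x m → lookup x i ≡ lookup x m
minimalIn-≡ i∈S m∈S i-min m-min = ≤-antisym (i-min _ m∈S) (m-min _ i∈S)

notMinimalIn-above : ∀ {S} {x : Vec ℚ k} {i m} → i ∈ S →
                     MinimalIn S x m → ¬ MinimalIn S x i → lookup x m < lookup x i
notMinimalIn-above {x = x} {i} {m} i∈S m-min ¬i-min with lookup x m <? lookup x i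
... | yes xm<xi = xm<xi
... | no xm≮xi = contradiction (λ j j∈S → ≤-trans (≮⇒≥ xm≮xi) (m-min j j∈S)) ¬i-min

minimal-restrict : (S : Subset k) (x : Vec ℚ k) (p : Fin ∣ S ∣) →
                   Minimal (restrict (enumerate S) x) p ⇔ MinimalIn S x (enumerate S p)
minimal-restrict S x p = mk⇔ restricted⇒ ⇒restricted
  where
  restricted⇒ : Minimal (restrict (enumerate S) x) p → MinimalIn S x (enumerate S p)
  restricted⇒ p-min j j∈S with enumerate-onto S j∈S
  ... | q , refl = subst₂ _≤_ (lookup-restrict _ x p) (lookup-restrict _ x q) (p-min q)
  ⇒restricted : MinimalIn S x (enumerate S p) → Minimal (restrict (enumerate S) x) p
  ⇒restricted p-min q = subst₂ _≤_ (sym (lookup-restrict _ x p)) (sym (lookup-restrict _ x q))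
                                   (p-min (enumerate S q) (enumerate-∈ S q))

⟦⟧ᶜ-map⁺ : {A : Set} (f : A → MinAffineOver k) {v : Vec ℚ k} →
           (∀ a → ⟦ f a ⟧ᴹ v) → ∀ as → ⟦ map f as ⟧ᶜ v
⟦⟧ᶜ-map⁺ f v-f [] = tt
⟦⟧ᶜ-map⁺ f v-f (a ∷ as) = v-f a , ⟦⟧ᶜ-map⁺ f v-f as

⟦⟧ᶜ-map⁻ : {A : Set} (f : A → MinAffineOver k) {v : Vec ℚ k} {a : A} {as : List A} →
           ⟦ map f as ⟧ᶜ v → a ∈ₗ as → ⟦ f a ⟧ᴹ v
⟦⟧ᶜ-map⁻ f {as = _ ∷ _} (v-a , _) (here refl) = v-a
⟦⟧ᶜ-map⁻ f {as = _ ∷ _} (_ , v-as) (there a∈as) = ⟦⟧ᶜ-map⁻ f v-as a∈as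

sameOrderOn-addMinimum : ∀ {h : ℚ → ℚ} {S m c} {v w z : Vec ℚ k} →
                         StrictMono h → m ∈ S → MinimalIn S v m →
                         (∀ j → c < lookup w j) → SameOrderOn (_∈ S ∖ m) v w →
                         (∀ {i} → i ∈ S → MinimalIn S v i → lookup z i ≡ h c) →
                         (∀ {i} → i ∈ S → ¬ MinimalIn S v i → lookup z i ≡ h (lookup w i)) →
                         SameOrderOn (_∈ S) v z
sameOrderOn-addMinimum {h = h} {S} {m} {c} {v} {w} {z} h-mono m∈S m-min c<w v~w z-low z-high = sameOrder z-< z-≡
  where
  ∈S∖m : ∀ {i} → i ∈ S → ¬ MinimalIn S v i → i ∈ S ∖ m
  ∈S∖m i∈S ¬i-min = x∈p∧x≢y⇒x∈p-y i∈S λ i≡m → ¬i-min (subst (MinimalIn S v) (sym i≡m) m-min)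
  level : ∀ {i} → i ∈ S → MinimalIn S v i → lookup v i ≡ lookup v m
  level i∈S i-min = minimalIn-≡ {x = v} i∈S m∈S i-min m-min
  above : ∀ {i} → i ∈ S → ¬ MinimalIn S v i → lookup v m < lookup v i
  above i∈S = notMinimalIn-above {x = v} i∈S m-min
  z-< : ∀ i j → i ∈ S → j ∈ S → lookup v i < lookup v j → lookup z i < lookup z j
  z-< i j i∈S j∈S vi<vj with minimalIn? S v i | minimalIn? S v j
  ... | yes i-min | yes j-min = ⊥-elim (<⇒≢ vi<vj (trans (level i∈S i-min) (sym (level j∈S j-min))))
  ... | yes i-min | no ¬j-min =
        subst₂ _<_ (sym (z-low i∈S i-min)) (sym (z-high j∈S ¬j-min)) (h-mono _ _ (c<w j))
  ... | no ¬i-min | yes j-min =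
        ⊥-elim (<-asym vi<vj (subst (_< lookup v i) (sym (level j∈S j-min)) (above i∈S ¬i-min)))
  ... | no ¬i-min | no ¬j-min =
        subst₂ _<_ (sym (z-high i∈S ¬i-min)) (sym (z-high j∈S ¬j-min))
               (h-mono _ _ (preserves-< v~w i j (∈S∖m i∈S ¬i-min) (∈S∖m j∈S ¬j-min) vi<vj))
  z-≡ : ∀ i j → i ∈ S → j ∈ S → lookup v i ≡ lookup v j → lookup z i ≡ lookup z j
  z-≡ i j i∈S j∈S vi≡vj with minimalIn? S v i | minimalIn? S v j
  ... | yes i-min | yes j-min = trans (z-low i∈S i-min) (sym (z-low j∈S j-min))
  ... | yes i-min | no ¬j-min = ⊥-elim (<⇒≢ (above j∈S ¬j-min) (trans (sym (level i∈S i-min)) vi≡vj))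
  ... | no ¬i-min | yes j-min = ⊥-elim (<⇒≢ (above i∈S ¬i-min) (trans (sym (level j∈S j-min)) (sym vi≡vj)))
  ... | no ¬i-min | no ¬j-min =
        trans (z-high i∈S ¬i-min)
              (trans (cong h (preserves-≡ v~w i j (∈S∖m i∈S ¬i-min) (∈S∖m j∈S ¬j-min) vi≡vj))
                     (sym (z-high j∈S ¬j-min)))

-- Relations preserved by mx are min-affine definable

module _ {α β : ℚ → ℚ} (params : MxParams α β) {R : Rel k}
         (R-invariant : OrderInvariant R) (R-mx : Preserves₂ (mx α β) R) where
  open Mx params

  minimumPatterns : (S : Subset k) → BRel ∣ S ∣
  minimumPatterns S t = ∃ λ u → R u × MinIndicator t (restrict (enumerate S) u)

  mx-realises-aOp : (σ : Fin n → Fin k) {t s : Vec Bool n} {a b : ℚ} {u w : Vec ℚ k} → R u → R w →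
                    AtLevel a t (restrict σ u) → AtLevel b s (restrict σ w) →
                    ∃ λ z → R z × AtLevel (α a) (zipWith aOp t s) (restrict σ z)
  mx-realises-aOp σ {s = s} {a} {b} {u} {w} Ru Rw u-lvl w-lvl =
    let g , g-mono , gb≡a = translation b a
        gw-lvl : AtLevel a s (restrict σ (mapᵥ g w))
        gw-lvl = subst₂ (λ d y → AtLevel d s y) gb≡a (sym (restrict-map σ g w)) (atLevel-map g-mono w-lvl)
    in zipWith (mx α β) u (mapᵥ g w) ,
       R-mx u (mapᵥ g w) Ru (R-invariant (strictMono-≃ g-mono w) Rw) ,
       subst (AtLevel (α a) _) (sym (restrict-zipWith σ (mx α β) u (mapᵥ g w))) (atLevel-mx-aOp params u-lvl gw-lvl)

  minimumPatterns-nearAffine : (S : Subset k) → NearAffine (minimumPatterns S)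
  minimumPatterns-nearAffine S t s (inj₂ refl) s∈ = subst (withOnes (minimumPatterns S)) (sym (ones-aOp s)) s∈
  minimumPatterns-nearAffine S t s t∈ (inj₂ refl) = subst (withOnes (minimumPatterns S)) (sym (aOp-ones t)) t∈
  minimumPatterns-nearAffine S t s (inj₁ (u , Ru , u-t)) (inj₁ (w , Rw , w-s)) with ones-or-zero (zipWith aOp t s)
  ... | inj₁ ts≡ones = inj₂ ts≡ones
  ... | inj₂ (p , ts-p) with ∃-minimal p (restrict (enumerate S) u) | ∃-minimal p (restrict (enumerate S) w)
  ...   | i , i-min | j , j-min =
          let z , Rz , z-lvl = mx-realises-aOp (enumerate S) Ru Rw
                                 (minIndicator⇒atLevel u-t i-min) (minIndicator⇒atLevel w-s j-min)
          in inj₁ (z , Rz , atLevel⇒minIndicator z-lvl ts-p)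

  minimumFormula : Subset k → MinAffineOver k
  minimumFormula S = record
    { n = ∣ S ∣ ; σ = enumerate S ; σ-inj = enumerate-injective S
    ; T = minimumPatterns S ; T-near = minimumPatterns-nearAffine S }

  R⇒minimumFormula : ∀ {v} → R v → ∀ S → ⟦ minimumFormula S ⟧ᴹ v
  R⇒minimumFormula {v} Rv S with minIndicator-exists (restrict (enumerate S) v)
  ... | t , v-t = t , (v , Rv , v-t) , minIndicator⇒clause v-t

  minimumFormula⇒sameMinima : ∀ {v} S → ⟦ minimumFormula S ⟧ᴹ v →
                              ∃ λ u → R u × (∀ {i} → i ∈ S → MinimalIn S v i ⇔ MinimalIn S u i)
  minimumFormula⇒sameMinima {v} S (t , (u , Ru , u-t) , v-clause) = u , Ru , same
    where
    same : ∀ {i} → i ∈ S → MinimalIn S v i ⇔ MinimalIn S u i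
    same i∈S with enumerate-onto S i∈S
    ... | p , refl with minIndicator-zero u-t p
    ...   | z , tz =
          minimal-restrict S u p ⇔-∘ (indicates u-t p ⇔-∘ (⇔-sym (indicates v-t p) ⇔-∘ ⇔-sym (minimal-restrict S v p)))
      where
      v-t : MinIndicator t (restrict (enumerate S) v)
      v-t = clause⇒minIndicator v-clause tz

  module _ (v : Vec ℚ k) (v-formulas : ∀ S → ⟦ minimumFormula S ⟧ᴹ v) where

    Realised : Subset k → Set
    Realised S = ∃ λ w → R w × SameOrderOn (_∈ S) v w

    -- Rescale u so that its minimum on S falls below w and the rest of S above w; mx then
    -- copies the minimum level of v from u and the remaining order from w.
    minimum-split : ∀ {S m} → m ∈ S → MinimalIn S v m → Realised (S ∖ m) →
                    (∃ λ u → R u × (∀ {i} → i ∈ S → MinimalIn S v i ⇔ MinimalIn S u i)) → Realised S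
    minimum-split {S} {m} m∈S m-min (w , Rw , v~w) (u , Ru , same-min)
      with strictLowerBound (lookup w) | strictUpperBound (lookup w)
    ... | lw , lw<w | hw , w<hw
      with separatingMap (λ i → (i ∈? S) ×-dec ¬? (minimalIn? S v i)) (lookup u) (<-trans (lw<w m) (w<hw m))
             (λ (i∈S , ¬i-min) →
                notMinimalIn-above {x = u} i∈S (to (same-min m∈S) m-min) (¬i-min ∘ from (same-min i∈S)))
    ...   | g , g-mono , gm≡lw , hw≤g =
              z , R-mx (mapᵥ g u) w (R-invariant (strictMono-≃ g-mono u) Ru) Rw ,
              sameOrderOn-addMinimum α-mono m∈S m-min lw<w v~w z-low z-high
      where
      z : Vec ℚ k
      z = zipWith (mx α β) (mapᵥ g u) w
      lookup-z : ∀ i → lookup z i ≡ mx α β (g (lookup u i)) (lookup w i)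
      lookup-z i = trans (lookup-zipWith (mx α β) i (mapᵥ g u) w)
                         (cong (λ q → mx α β q (lookup w i)) (lookup-map i g u))
      z-low : ∀ {i} → i ∈ S → MinimalIn S v i → lookup z i ≡ α lw
      z-low {i} i∈S i-min = trans (lookup-z i) (trans (cong (λ q → mx α β q (lookup w i)) gui≡lw) (mx-< (lw<w i)))
        where
        gui≡lw : g (lookup u i) ≡ lw
        gui≡lw = trans (cong g (minimalIn-≡ {x = u} i∈S m∈S (to (same-min i∈S) i-min) (to (same-min m∈S) m-min)))
                       gm≡lw
      z-high : ∀ {i} → i ∈ S → ¬ MinimalIn S v i → lookup z i ≡ α (lookup w i)
      z-high {i} i∈S ¬i-min = trans (lookup-z i) (mx-> (<-≤-trans (w<hw i) (hw≤g (i∈S , ¬i-min))))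

    realised : ∀ S → Acc _⊂_ S → Realised S
    realised S (acc smaller) with argminℚ (_∈? S) (lookup v)
    ... | inj₂ (m , m∈S , m-min) =
          minimum-split m∈S m-min (realised (S ∖ m) (smaller (x∈p⇒p-x⊂p m∈S)))
                        (minimumFormula⇒sameMinima {v} S (v-formulas S))
    ... | inj₁ S-empty =
          let u , Ru , _ = minimumFormula⇒sameMinima {v} S (v-formulas S)
          in u , Ru , sameOrder (λ i _ i∈S _ → ⊥-elim (S-empty i i∈S)) (λ i _ i∈S _ → ⊥-elim (S-empty i i∈S))

    minimumFormulas⇒R : R v
    minimumFormulas⇒R =
      let w , Rw , v~w = realised Subset.⊤ (⊂-wellFounded Subset.⊤)
          v≃w = sameOrder (λ i j _ _ → preserves-< v~w i j ∈⊤ ∈⊤) (λ i j _ _ → preserves-≡ v~w i j ∈⊤ ∈⊤)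
      in R-invariant (sameOrderOn-sym v≃w) Rw

  preserved⇒minAffineDefinable : MinAffineDefinable R
  preserved⇒minAffineDefinable = map minimumFormula (allSubsets k) , λ v → mk⇔
    (λ Rv → ⟦⟧ᶜ-map⁺ minimumFormula (R⇒minimumFormula Rv) (allSubsets k))
    (λ v-formulas → minimumFormulas⇒R v λ S → ⟦⟧ᶜ-map⁻ minimumFormula v-formulas (∈-allSubsets S))

theorem3p4 : (α β : ℚ → ℚ) → MxParams α β →
    (k : ℕ) (R : Rel k) → Temporal R →
    (Preserves₂ (mx α β) R → MinAffineDefinable R) ×
    (MinAffineDefinable R → Preserves₂ (mx α β) R)
theorem3p4 α β params k R R-temporal =
  preserved⇒minAffineDefinable params (temporal⇒orderInvariant R-temporal) ,
  minAffineDefinable⇒preserved params
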